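{- Let $G=(V,E)$ be an undirected graph with positive edge weights $w$, let $VC\subseteq V$ be a vertex cover of $G$ and $X=V\setminus VC$. Then for every $S\subseteq VC$, $$\tfrac12\,\Delta_G(S)\le \Delta_{G_{VC}}(S)\le \Delta_G(S).$$
   Context: $X$ is an independent set. For $x\in X$ with neighborhood $N(x)\subseteq VC$ and $S\subseteq VC$, let $w(x,S)=\sum_{u\in S\cap N(x)}w(x,u)$ and $w^{(x)}(S)=\min\{w(x,S),w(x,VC\setminus S)\}$. Let $G\setminus X$ denote the subgraph of $G$ induced on $VC$, and for a graph $F$ on $VC$ let $\Delta_F(S)$ be the total weight of edges of $F$ with exactly one endpoint in $S$. Define $\Delta_G(S):=\Delta_{G\setminus X}(S)+\sum_{x\in X}w^{(x)}(S)$ (the weight of the cheapest cut of $G$ whose restriction to $VC$ is $S$). For $x\in X$ let $K_x$ be the clique on $N(x)$ in which each pair $u,v\in N(x)$ is joined by an edge of weight $\frac{w(x,u)\,w(x,v)}{\sum_{i\in N(x)}w(x,i)}$. Let $G_{VC}$ be the multigraph on $VC$ given by $(G\setminus X)\cup\bigcup_{x\in X}K_x$, and $\Delta_{G_{VC}}(S)$ the total weight of its edges with exactly one endpoint in $S$.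
   Formalization: The edge weights $w$ are rational rather than real. -}

module Defs where

open import Data.Nat using (ℕ; zero; suc)
open import Data.Fin using (Fin; zero; suc)
open import Data.Fin.Subset using (Subset; _∈_; _∉_; ∁; _∩_)
open import Data.Fin.Subset.Properties using (_∈?_)
open import Data.Rational using (ℚ; 0ℚ; _+_; _*_; _÷_; _⊓_)
open import Data.Rational.Properties using (_≟_)
import Data.Rational.Base as ℚB
open import Relation.Nullary using (yes; no)

-- A weighted undirected graph on the vertex set Fin n is given by a weight
-- function w : Fin n → Fin n → ℚ; {u,v} is an edge iff w u v > 0
-- (hypotheses: symmetric, nonnegative, no loops are imposed in the theorem).
Weight : ℕ → Set
Weight n = Fin n → Fin n → ℚ

Σ : ∀ {n} → (Fin n → ℚ) → ℚ
Σ {zero}  f = 0ℚ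
Σ {suc n} f = f zero + Σ (λ i → f (suc i))

Σ∈ : ∀ {n} → Subset n → (Fin n → ℚ) → ℚ
Σ∈ p f = Σ (λ i → [ i ∈? p ] f i)
  where
  [_]_ : ∀ {A : Set} → Relation.Nullary.Dec A → ℚ → ℚ
  [ yes _ ] q = q
  [ no _ ]  q = 0ℚ

-- division, with the convention p / 0 = 0 (only used when an x ∈ X is isolated,
-- in which case K_x has no edges anyway)
_÷₀_ : ℚ → ℚ → ℚ
p ÷₀ q with q ≟ 0ℚ
... | yes _  = 0ℚ
... | no q≢0 = _÷_ p q {{ℚB.≢-nonZero q≢0}}

IsVertexCover : ∀ {n} → Weight n → Subset n → Set
IsVertexCover w VC = ∀ u v → u ∉ VC → v ∉ VC → w u v ≡ 0ℚ
  where open import Relation.Binary.PropositionalEquality using (_≡_)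

module _ {n : ℕ} (w : Weight n) (VC : Subset n) where

  X : Subset n
  X = ∁ VC

  -- Δ_{G∖X}(S): total weight of edges inside VC with exactly one endpoint in S
  -- (each such edge counted once, via the ordered pair (u ∈ S, v ∈ VC ∖ S))
  ΔGX : Subset n → ℚ
  ΔGX S = Σ∈ S (λ u → Σ∈ (VC ∩ ∁ S) (λ v → w u v))

  -- w(x,T) = Σ_{u ∈ T ∩ N(x)} w(x,u)   (w x u = 0 for non-neighbours)
  wx : Fin n → Subset n → ℚ
  wx x T = Σ∈ T (λ u → w x u)

  wmin : Fin n → Subset n → ℚ
  wmin x S = wx x S ⊓ wx x (VC ∩ ∁ S)

  ΔG : Subset n → ℚ
  ΔG S = ΔGX S + Σ∈ X (λ x → wmin x S)

  Wtot : Fin n → ℚ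
  Wtot x = Σ (λ i → w x i)

  Kx : Fin n → Fin n → Fin n → ℚ
  Kx x u v = (w x u * w x v) ÷₀ Wtot x

  -- Δ_{G_VC}(S) for G_VC = (G∖X) ∪ ⋃_{x∈X} K_x
  ΔGVC : Subset n → ℚ
  ΔGVC S = ΔGX S + Σ∈ X (λ x → Σ∈ S (λ u → Σ∈ (VC ∩ ∁ S) (λ v → Kx x u v)))

-- Fix x ∈ X with a = w(x,S) and b = w(x,VC ∖ S). Every neighbour of x lies in VC, so the
-- total weight at x is a + b, and the clique K_x contributes Σ_{u∈S, v∈VC∖S} w(x,u) w(x,v) / (a + b)
-- = ab / (a + b) to the cut, while x contributes min(a,b) to Δ_G(S). Finally
-- ½ min(a,b) ≤ ab / (a + b) ≤ min(a,b) for a, b ≥ 0, and summing over x ∈ X gives both bounds,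
-- the edges of G ∖ X contributing equally to both sides.
module Submission where

open import Defs
open import Data.Nat using (ℕ; zero; suc)
open import Data.Fin using (Fin; zero; suc)
open import Data.Fin.Subset using (Subset; _∉_; _⊆_; _∈_; ∁; _∩_)
open import Data.Fin.Subset.Properties using (_∈?_; x∈∁p⇒x∉p; x∉p⇒x∈∁p; p∩q⊆q; x∈p∩q⁺)
open import Data.Rational
  using (ℚ; 0ℚ; 1ℚ; ½; _≤_; _+_; _*_; _÷_; 1/_; _⊓_; NonZero; Positive; nonNegative; ≢-nonZero)
open import Data.Rational.Properties
  using ( _≟_; _≤?_; ≤-refl; ≤-reflexive; ≤-trans; ≤-total; module ≤-Reasoning
        ; +-identityˡ; +-identityʳ; +-mono-≤; +-monoˡ-≤; +-monoʳ-≤; +-0-commutativeMonoid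
        ; *-assoc; *-comm; *-identityˡ; *-identityʳ; *-zeroʳ; *-inverseˡ; *-distribˡ-+
        ; *-monoˡ-≤-nonNeg; *-monoʳ-≤-nonNeg; *-cancelʳ-≤-pos; pos⇒nonZero; nonNeg∧nonZero⇒pos
        ; ⊓-glb; p≤q⇒p⊓q≡p; p≥q⇒p⊓q≡q )
open import Data.Rational.Solver using (module +-*-Solver)
open import Algebra.Bundles using (CommutativeMonoid)
open import Algebra.Properties.CommutativeSemigroup
  (CommutativeMonoid.commutativeSemigroup +-0-commutativeMonoid) using (interchange)
open import Data.Product using (_×_; _,_)
open import Data.Sum using (inj₁; inj₂)
open import Relation.Nullary using (Dec; yes; no; contradiction)
open import Relation.Nullary.Decidable using (toWitness)
open import Function using (_∘_)
open import Relation.Binary.PropositionalEquality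

p÷q*q≡p : ∀ p q .{{_ : NonZero q}} → (p ÷ q) * q ≡ p
p÷q*q≡p p q = begin
  (p * 1/ q) * q   ≡⟨ *-assoc p (1/ q) q ⟩
  p * (1/ q * q)   ≡⟨ cong (p *_) (*-inverseˡ q) ⟩
  p * 1ℚ           ≡⟨ *-identityʳ p ⟩
  p                ∎
  where open ≡-Reasoning

p≤q*r⇒p÷r≤q : ∀ {p q} r .{{_ : Positive r}} → p ≤ q * r → (p ÷ r) {{pos⇒nonZero r}} ≤ q
p≤q*r⇒p÷r≤q {p} r p≤qr = *-cancelʳ-≤-pos r (subst (_≤ _) (sym (p÷q*q≡p p r {{pos⇒nonZero r}})) p≤qr)

p*r≤q⇒p≤q÷r : ∀ {p q} r .{{_ : Positive r}} → p * r ≤ q → p ≤ (q ÷ r) {{pos⇒nonZero r}}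
p*r≤q⇒p≤q÷r {q = q} r pr≤q = *-cancelʳ-≤-pos r (subst (_ ≤_) (sym (p÷q*q≡p q r {{pos⇒nonZero r}})) pr≤q)

p÷₀r≡p*[1÷₀r] : ∀ p r → p ÷₀ r ≡ p * (1ℚ ÷₀ r)
p÷₀r≡p*[1÷₀r] p r with r ≟ 0ℚ
... | yes _ = sym (*-zeroʳ p)
... | no _  = cong (p *_) (sym (*-identityˡ _))

pq÷₀r≤p : ∀ {p q r} → 0ℚ ≤ p → 0ℚ ≤ q → q ≤ r → (p * q) ÷₀ r ≤ p
pq÷₀r≤p {p} {q} {r} 0≤p 0≤q q≤r with r ≟ 0ℚ
... | yes _   = 0≤p
... | no r≢0 = p≤q*r⇒p÷r≤q r (*-monoˡ-≤-nonNeg p {{nonNegative 0≤p}} q≤r)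
  where
  instance
    r-pos : Positive r
    r-pos = nonNeg∧nonZero⇒pos r {{nonNegative (≤-trans 0≤q q≤r)}} {{≢-nonZero r≢0}}

½p≤pq÷₀r : ∀ {p q r} → 0ℚ ≤ p → p ≤ r → r ≤ q + q → ½ * p ≤ (p * q) ÷₀ r
½p≤pq÷₀r {p} {q} {r} 0≤p p≤r r≤q+q with r ≟ 0ℚ
... | yes refl = ≤-trans (*-monoˡ-≤-nonNeg ½ p≤r) (≤-reflexive (*-zeroʳ ½))
... | no r≢0  = p*r≤q⇒p≤q÷r r (begin
  (½ * p) * r  ≡⟨ solve 3 (λ h p r → (h :* p) :* r := p :* (h :* r)) refl ½ p r ⟩
  p * (½ * r)  ≤⟨ *-monoˡ-≤-nonNeg p {{nonNegative 0≤p}} ½r≤q ⟩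
  p * q        ∎)
  where
  open ≤-Reasoning
  open +-*-Solver
  instance
    r-pos : Positive r
    r-pos = nonNeg∧nonZero⇒pos r {{nonNegative (≤-trans 0≤p p≤r)}} {{≢-nonZero r≢0}}
  ½r≤q : ½ * r ≤ q
  ½r≤q = ≤-trans (*-monoˡ-≤-nonNeg ½ r≤q+q) (≤-reflexive (solve 1 (λ q → con ½ :* (q :+ q) := q) refl q))

p≤p+q : ∀ {p q} → 0ℚ ≤ q → p ≤ p + q
p≤p+q {p} {q} 0≤q = subst (_≤ p + q) (+-identityʳ p) (+-monoʳ-≤ p 0≤q)

p≤q+p : ∀ {p q} → 0ℚ ≤ q → p ≤ q + p
p≤q+p {p} {q} 0≤q = subst (_≤ q + p) (+-identityˡ p) (+-monoˡ-≤ p 0≤q)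

½p≤p : ∀ {p} → 0ℚ ≤ p → ½ * p ≤ p
½p≤p {p} 0≤p = subst (½ * p ≤_) (*-identityˡ p) (*-monoʳ-≤-nonNeg p {{nonNegative 0≤p}} ½≤1)
  where
  ½≤1 : ½ ≤ 1ℚ
  ½≤1 = toWitness {a? = ½ ≤? 1ℚ} _

pq÷₀[p+q]≤p⊓q : ∀ {p q} → 0ℚ ≤ p → 0ℚ ≤ q → (p * q) ÷₀ (p + q) ≤ p ⊓ q
pq÷₀[p+q]≤p⊓q {p} {q} 0≤p 0≤q = ⊓-glb
  (pq÷₀r≤p 0≤p 0≤q (p≤q+p 0≤p))
  (subst (λ z → z ÷₀ (p + q) ≤ q) (*-comm q p) (pq÷₀r≤p 0≤q 0≤p (p≤p+q 0≤q)))

½[p⊓q]≤pq÷₀[p+q] : ∀ {p q} → 0ℚ ≤ p → 0ℚ ≤ q → ½ * (p ⊓ q) ≤ (p * q) ÷₀ (p + q)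
½[p⊓q]≤pq÷₀[p+q] {p} {q} 0≤p 0≤q with ≤-total p q
... | inj₁ p≤q = subst (λ m → ½ * m ≤ (p * q) ÷₀ (p + q)) (sym (p≤q⇒p⊓q≡p p≤q))
  (½p≤pq÷₀r 0≤p (p≤p+q 0≤q) (+-monoˡ-≤ q p≤q))
... | inj₂ q≤p = subst₂ (λ m z → ½ * m ≤ z ÷₀ (p + q)) (sym (p≥q⇒p⊓q≡q q≤p)) (*-comm q p)
  (½p≤pq÷₀r 0≤q (p≤q+p 0≤p) (+-monoʳ-≤ p q≤p))

Σ-cong : ∀ {n} {f g : Fin n → ℚ} → (∀ i → f i ≡ g i) → Σ f ≡ Σ g
Σ-cong {zero}  f≡g = refl
Σ-cong {suc n} f≡g = cong₂ _+_ (f≡g zero) (Σ-cong (f≡g ∘ suc))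

Σ-mono-≤ : ∀ {n} {f g : Fin n → ℚ} → (∀ i → f i ≤ g i) → Σ f ≤ Σ g
Σ-mono-≤ {zero}  f≤g = ≤-refl
Σ-mono-≤ {suc n} f≤g = +-mono-≤ (f≤g zero) (Σ-mono-≤ (f≤g ∘ suc))

Σ-nonNeg : ∀ {n} {f : Fin n → ℚ} → (∀ i → 0ℚ ≤ f i) → 0ℚ ≤ Σ f
Σ-nonNeg {zero}  0≤f = ≤-refl
Σ-nonNeg {suc n} 0≤f = +-mono-≤ (0≤f zero) (Σ-nonNeg (0≤f ∘ suc))

Σ-distrib-+ : ∀ {n} (f g : Fin n → ℚ) → Σ (λ i → f i + g i) ≡ Σ f + Σ g
Σ-distrib-+ {zero}  f g = refl
Σ-distrib-+ {suc n} f g = begin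
  (f zero + g zero) + Σ (λ i → f (suc i) + g (suc i))  ≡⟨ cong (f zero + g zero +_) (Σ-distrib-+ (f ∘ suc) (g ∘ suc)) ⟩
  (f zero + g zero) + (Σ (f ∘ suc) + Σ (g ∘ suc))      ≡⟨ interchange (f zero) (g zero) _ _ ⟩
  (f zero + Σ (f ∘ suc)) + (g zero + Σ (g ∘ suc))      ∎
  where open ≡-Reasoning

Σ-*ˡ : ∀ {n} (k : ℚ) (f : Fin n → ℚ) → Σ (λ i → k * f i) ≡ k * Σ f
Σ-*ˡ {zero}  k f = sym (*-zeroʳ k)
Σ-*ˡ {suc n} k f = begin
  k * f zero + Σ (λ i → k * f (suc i))  ≡⟨ cong (k * f zero +_) (Σ-*ˡ k (f ∘ suc)) ⟩
  k * f zero + k * Σ (f ∘ suc)          ≡⟨ *-distribˡ-+ k (f zero) _ ⟨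
  k * (f zero + Σ (f ∘ suc))            ∎
  where open ≡-Reasoning

select : ∀ {A : Set} → Dec A → ℚ → ℚ
select (yes _) q = q
select (no _)  q = 0ℚ

select-mono-≤ : ∀ {A : Set} {p q} (a? : Dec A) → (A → p ≤ q) → select a? p ≤ select a? q
select-mono-≤ (yes a) p≤q = p≤q a
select-mono-≤ (no _)  p≤q = ≤-refl

select-nonNeg : ∀ {A : Set} {p} (a? : Dec A) → (A → 0ℚ ≤ p) → 0ℚ ≤ select a? p
select-nonNeg (yes a) 0≤p = 0≤p a
select-nonNeg (no _)  0≤p = ≤-refl

select-*ˡ : ∀ {A : Set} k p (a? : Dec A) → select a? (k * p) ≡ k * select a? p
select-*ˡ k p (yes _) = refl
select-*ˡ k p (no _)  = sym (*-zeroʳ k)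

-- The summand of Σ∈ is local to Defs and cannot be named, so the type of Σ∈-summand≡select
-- is left to unification against its use in Σ∈-select (hence the mutual block).
mutual
  Σ∈-select : ∀ {n} (p : Subset n) (f : Fin n → ℚ) → Σ∈ p f ≡ Σ (λ i → select (i ∈? p) (f i))
  Σ∈-select p f = Σ-cong (Σ∈-summand≡select p f)

  Σ∈-summand≡select : ∀ {n} (p : Subset n) (f : Fin n → ℚ) i → _ ≡ select (i ∈? p) (f i)
  Σ∈-summand≡select p f i with i ∈? p
  ... | yes _ = refl
  ... | no _  = refl

module _ {n : ℕ} (p : Subset n) where

  Σ∈-cong : ∀ {f g : Fin n → ℚ} → (∀ i → f i ≡ g i) → Σ∈ p f ≡ Σ∈ p g
  Σ∈-cong {f} {g} f≡g = begin
    Σ∈ p f                            ≡⟨ Σ∈-select p f ⟩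
    Σ (λ i → select (i ∈? p) (f i))  ≡⟨ Σ-cong (λ i → cong (select (i ∈? p)) (f≡g i)) ⟩
    Σ (λ i → select (i ∈? p) (g i))  ≡⟨ Σ∈-select p g ⟨
    Σ∈ p g                            ∎
    where open ≡-Reasoning

  Σ∈-mono-≤ : ∀ {f g : Fin n → ℚ} → (∀ i → i ∈ p → f i ≤ g i) → Σ∈ p f ≤ Σ∈ p g
  Σ∈-mono-≤ {f} {g} f≤g = subst₂ _≤_ (sym (Σ∈-select p f)) (sym (Σ∈-select p g))
    (Σ-mono-≤ (λ i → select-mono-≤ (i ∈? p) (f≤g i)))

  Σ∈-nonNeg : ∀ {f : Fin n → ℚ} → (∀ i → i ∈ p → 0ℚ ≤ f i) → 0ℚ ≤ Σ∈ p f
  Σ∈-nonNeg {f} 0≤f = subst (0ℚ ≤_) (sym (Σ∈-select p f))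
    (Σ-nonNeg (λ i → select-nonNeg (i ∈? p) (0≤f i)))

  Σ∈-*ˡ : ∀ k (f : Fin n → ℚ) → Σ∈ p (λ i → k * f i) ≡ k * Σ∈ p f
  Σ∈-*ˡ k f = begin
    Σ∈ p (λ i → k * f i)                  ≡⟨ Σ∈-select p (λ i → k * f i) ⟩
    Σ (λ i → select (i ∈? p) (k * f i))  ≡⟨ Σ-cong (λ i → select-*ˡ k (f i) (i ∈? p)) ⟩
    Σ (λ i → k * select (i ∈? p) (f i))  ≡⟨ Σ-*ˡ k (λ i → select (i ∈? p) (f i)) ⟩
    k * Σ (λ i → select (i ∈? p) (f i))  ≡⟨ cong (k *_) (Σ∈-select p f) ⟨
    k * Σ∈ p f                            ∎
    where open ≡-Reasoning

  Σ∈-*ʳ : ∀ k (f : Fin n → ℚ) → Σ∈ p (λ i → f i * k) ≡ Σ∈ p f * k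
  Σ∈-*ʳ k f = begin
    Σ∈ p (λ i → f i * k)  ≡⟨ Σ∈-cong (λ i → *-comm (f i) k) ⟩
    Σ∈ p (λ i → k * f i)  ≡⟨ Σ∈-*ˡ k f ⟩
    k * Σ∈ p f            ≡⟨ *-comm k _ ⟩
    Σ∈ p f * k            ∎
    where open ≡-Reasoning

  Σ∈-÷₀ : ∀ r (f : Fin n → ℚ) → Σ∈ p (λ i → f i ÷₀ r) ≡ Σ∈ p f ÷₀ r
  Σ∈-÷₀ r f = begin
    Σ∈ p (λ i → f i ÷₀ r)          ≡⟨ Σ∈-cong (λ i → p÷₀r≡p*[1÷₀r] (f i) r) ⟩
    Σ∈ p (λ i → f i * (1ℚ ÷₀ r))  ≡⟨ Σ∈-*ʳ (1ℚ ÷₀ r) f ⟩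
    Σ∈ p f * (1ℚ ÷₀ r)            ≡⟨ p÷₀r≡p*[1÷₀r] _ r ⟨
    Σ∈ p f ÷₀ r                    ∎
    where open ≡-Reasoning

  Σ∈-partition : ∀ q (f : Fin n → ℚ) → (∀ i → i ∈ p → i ∉ q) → (∀ i → i ∉ p → i ∉ q → f i ≡ 0ℚ) →
                 Σ∈ p f + Σ∈ q f ≡ Σ f
  Σ∈-partition q f disjoint outside = begin
    Σ∈ p f + Σ∈ q f          ≡⟨ cong₂ _+_ (Σ∈-select p f) (Σ∈-select q f) ⟩
    Σ f|p + Σ f|q            ≡⟨ Σ-distrib-+ f|p f|q ⟨
    Σ (λ i → f|p i + f|q i)  ≡⟨ Σ-cong covers ⟩
    Σ f                      ∎
    where
    open ≡-Reasoning
    f|p f|q : Fin n → ℚ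
    f|p i = select (i ∈? p) (f i)
    f|q i = select (i ∈? q) (f i)
    covers : ∀ i → select (i ∈? p) (f i) + select (i ∈? q) (f i) ≡ f i
    covers i with i ∈? p | i ∈? q
    ... | yes i∈p | yes i∈q = contradiction i∈q (disjoint i i∈p)
    ... | yes _   | no _    = +-identityʳ (f i)
    ... | no _    | yes _   = +-identityˡ (f i)
    ... | no i∉p  | no i∉q  = sym (outside i i∉p i∉q)

Σ∈-Σ∈-* : ∀ {n} (p q : Subset n) (f g : Fin n → ℚ) → Σ∈ p (λ i → Σ∈ q (λ j → f i * g j)) ≡ Σ∈ p f * Σ∈ q g
Σ∈-Σ∈-* p q f g = begin
  Σ∈ p (λ i → Σ∈ q (λ j → f i * g j))  ≡⟨ Σ∈-cong p (λ i → Σ∈-*ˡ q (f i) g) ⟩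
  Σ∈ p (λ i → f i * Σ∈ q g)            ≡⟨ Σ∈-*ʳ p (Σ∈ q g) f ⟩
  Σ∈ p f * Σ∈ q g                      ∎
  where open ≡-Reasoning

module _ {n : ℕ} (w : Weight n) (VC : Subset n) where

  ΔK : Fin n → Subset n → ℚ
  ΔK x S = Σ∈ S (λ u → Σ∈ (VC ∩ ∁ S) (λ v → Kx w VC x u v))

  ΔK≡wx*wx÷₀Wtot : ∀ x S → ΔK x S ≡ (wx w VC x S * wx w VC x (VC ∩ ∁ S)) ÷₀ Wtot w VC x
  ΔK≡wx*wx÷₀Wtot x S = begin
    Σ∈ S (λ u → Σ∈ T (λ v → (w x u * w x v) ÷₀ W))  ≡⟨ Σ∈-cong S (λ u → Σ∈-÷₀ T W (λ v → w x u * w x v)) ⟩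
    Σ∈ S (λ u → Σ∈ T (λ v → w x u * w x v) ÷₀ W)    ≡⟨ Σ∈-÷₀ S W (λ u → Σ∈ T (λ v → w x u * w x v)) ⟩
    Σ∈ S (λ u → Σ∈ T (λ v → w x u * w x v)) ÷₀ W    ≡⟨ cong (_÷₀ W) (Σ∈-Σ∈-* S T (w x) (w x)) ⟩
    (Σ∈ S (w x) * Σ∈ T (w x)) ÷₀ W                  ∎
    where
    open ≡-Reasoning
    T = VC ∩ ∁ S
    W = Wtot w VC x

  wx+wx∖≡Wtot : IsVertexCover w VC → ∀ {x} → x ∉ VC → ∀ S →
                wx w VC x S + wx w VC x (VC ∩ ∁ S) ≡ Wtot w VC x
  wx+wx∖≡Wtot vc {x} x∉VC S = Σ∈-partition S (VC ∩ ∁ S) (w x) disjoint outside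
    where
    disjoint : ∀ i → i ∈ S → i ∉ VC ∩ ∁ S
    disjoint i i∈S i∈T = x∈∁p⇒x∉p (p∩q⊆q VC (∁ S) i∈T) i∈S
    outside : ∀ i → i ∉ S → i ∉ VC ∩ ∁ S → w x i ≡ 0ℚ
    outside i i∉S i∉T = vc x i x∉VC (λ i∈VC → i∉T (x∈p∩q⁺ (i∈VC , x∉p⇒x∈∁p i∉S)))

  module _ (w≥0 : ∀ u v → 0ℚ ≤ w u v) (vc : IsVertexCover w VC) where

    ΔGX-nonNeg : ∀ S → 0ℚ ≤ ΔGX w VC S
    ΔGX-nonNeg S = Σ∈-nonNeg S (λ u _ → Σ∈-nonNeg (VC ∩ ∁ S) (λ v _ → w≥0 u v))

    wx-nonNeg : ∀ x T → 0ℚ ≤ wx w VC x T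
    wx-nonNeg x T = Σ∈-nonNeg T (λ u _ → w≥0 x u)

    ΔK≡ab÷₀[a+b] : ∀ {x} → x ∉ VC → ∀ S →
                   let a = wx w VC x S; b = wx w VC x (VC ∩ ∁ S) in ΔK x S ≡ (a * b) ÷₀ (a + b)
    ΔK≡ab÷₀[a+b] {x} x∉VC S = trans (ΔK≡wx*wx÷₀Wtot x S)
      (cong ((wx w VC x S * wx w VC x (VC ∩ ∁ S)) ÷₀_) (sym (wx+wx∖≡Wtot vc x∉VC S)))

    ΔK≤wmin : ∀ {x} → x ∉ VC → ∀ S → ΔK x S ≤ wmin w VC x S
    ΔK≤wmin {x} x∉VC S = subst (_≤ wmin w VC x S) (sym (ΔK≡ab÷₀[a+b] x∉VC S))
      (pq÷₀[p+q]≤p⊓q (wx-nonNeg x S) (wx-nonNeg x (VC ∩ ∁ S)))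

    ½wmin≤ΔK : ∀ {x} → x ∉ VC → ∀ S → ½ * wmin w VC x S ≤ ΔK x S
    ½wmin≤ΔK {x} x∉VC S = subst (½ * wmin w VC x S ≤_) (sym (ΔK≡ab÷₀[a+b] x∉VC S))
      (½[p⊓q]≤pq÷₀[p+q] (wx-nonNeg x S) (wx-nonNeg x (VC ∩ ∁ S)))

theorem6p9 : (n : ℕ) (w : Weight n) →
    (∀ u v → w u v ≡ w v u) →
    (∀ u v → 0ℚ ≤ w u v) →
    (∀ u → w u u ≡ 0ℚ) →
    (VC : Subset n) → IsVertexCover w VC →
    (S : Subset n) → S ⊆ VC →
    (½ * ΔG w VC S ≤ ΔGVC w VC S) × (ΔGVC w VC S ≤ ΔG w VC S)
theorem6p9 n w _ w≥0 _ VC vc S _ = lower , upper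
  where
  D = ΔGX w VC S
  upper : ΔGVC w VC S ≤ ΔG w VC S
  upper = +-monoʳ-≤ D (Σ∈-mono-≤ (X w VC) (λ x x∈X → ΔK≤wmin w VC w≥0 vc (x∈∁p⇒x∉p x∈X) S))
  lower : ½ * ΔG w VC S ≤ ΔGVC w VC S
  lower = begin
    ½ * (D + Σ∈ (X w VC) (λ x → wmin w VC x S))    ≡⟨ *-distribˡ-+ ½ D _ ⟩
    ½ * D + ½ * Σ∈ (X w VC) (λ x → wmin w VC x S)  ≡⟨ cong (½ * D +_) (Σ∈-*ˡ (X w VC) ½ (λ x → wmin w VC x S)) ⟨
    ½ * D + Σ∈ (X w VC) (λ x → ½ * wmin w VC x S)  ≤⟨ +-mono-≤ (½p≤p (ΔGX-nonNeg w VC w≥0 vc S))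
      (Σ∈-mono-≤ (X w VC) (λ x x∈X → ½wmin≤ΔK w VC w≥0 vc (x∈∁p⇒x∉p x∈X) S)) ⟩
    D + Σ∈ (X w VC) (λ x → ΔK w VC x S)            ∎
    where open ≤-Reasoning
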